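{- Let $d\ge 1$ and $n\ge 1$ be integers. The number of $d$-ary multi-edge trees with $n$ vertices equals the number of $d$-ary trees with $n$ vertices, which is the Fuss–Catalan number $\frac{1}{n}\binom{nd}{n-1}$.
   Context: A plane (ordered) rooted multi-edge tree is a rooted plane tree in which each non-root vertex is joined to its parent by a positive number of (indistinguishable, parallel) edges; children of a vertex are linearly ordered. If a vertex has children joined to it by $k_1,\dots,k_r$ edges, its out-degree is $k_1+\dots+k_r$. A $d$-ary multi-edge tree is such a tree in which every vertex has out-degree at most $d$. A $d$-ary tree (pruned $d$-ary tree) is a rooted tree in which each vertex has $d$ distinct positions (first, ..., $d$-th) at which a child may be attached, each position holding at most one child. Trees are counted by their number of vertices. -}

module Defs where

open import Data.Nat using (ℕ; zero; suc; _+_; _≤ᵇ_)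
open import Data.Bool using (Bool; true; false; _∧_)
open import Data.List using (List; []; _∷_)
open import Data.Vec using (Vec; []; _∷_)
open import Data.Maybe using (Maybe; just; nothing)
open import Data.Product using (Σ; _×_; _,_)
open import Relation.Binary.PropositionalEquality using (_≡_)

-- A vertex is a (linearly ordered) list of children; each child comes
-- with a number m : ℕ encoding the POSITIVE multiplicity  suc m  of the
-- parallel edges joining it to its parent.

data MTree : Set where
  node : List (ℕ × MTree) → MTree

mutual
  msize : MTree → ℕ
  msize (node cs) = suc (msizes cs)

  msizes : List (ℕ × MTree) → ℕ
  msizes [] = 0
  msizes ((m , t) ∷ cs) = msize t + msizes cs

outdeg : List (ℕ × MTree) → ℕ
outdeg [] = 0
outdeg ((m , _) ∷ cs) = suc m + outdeg cs

mutual
  mDAry : ℕ → MTree → Bool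
  mDAry d (node cs) = (outdeg cs ≤ᵇ d) ∧ mDArys d cs

  mDArys : ℕ → List (ℕ × MTree) → Bool
  mDArys d [] = true
  mDArys d ((_ , t) ∷ cs) = mDAry d t ∧ mDArys d cs

DAryMultiEdgeTrees : ℕ → ℕ → Set
DAryMultiEdgeTrees d n = Σ MTree (λ t → (mDAry d t ≡ true) × (msize t ≡ n))

data DTree (d : ℕ) : Set where
  node : Vec (Maybe (DTree d)) d → DTree d

mutual
  dsize : ∀ {d} → DTree d → ℕ
  dsize (node cs) = suc (dsizes cs)

  dsizes : ∀ {d k} → Vec (Maybe (DTree d)) k → ℕ
  dsizes [] = 0
  dsizes (nothing ∷ cs) = dsizes cs
  dsizes (just t ∷ cs) = dsize t + dsizes cs

DAryTrees : ℕ → ℕ → Set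
DAryTrees d n = Σ (DTree d) (λ t → dsize t ≡ n)

-- Removing the root of a d-ary tree leaves a forest in d positions, each
-- empty or holding a d-ary tree.  Look at the first of h positions: if it
-- is empty drop it, otherwise replace it by the d positions below the root
-- of its tree.  So the number F(h, s) of forests in h positions with s
-- vertices satisfies the Raney recurrence F(h+1, s+1) = F(h, s+1) + F(h+d, s),
-- whose solution is F(h, s) = h/(h+sd) · C(h+sd, s) (Pascal's rule and
-- absorption); h = d gives the Fuss–Catalan number.
--
-- A multi-edge tree becomes a d-ary tree by writing a child joined by k
-- edges as k−1 empty positions followed by that child, and leaving the
-- remaining positions empty; this fits into d positions exactly when the
-- out-degree is at most d.

module Submission where

open import Defs
open import Axiom.UniquenessOfIdentityProofs using (module Decidable⇒UIP)
open import Data.Bool using (Bool; true; _∧_)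
import Data.Bool.Properties as Bool
open import Data.Empty using (⊥)
open import Data.Fin using (Fin)
open import Data.Fin.Properties using (+↔⊎; 0↔⊥; 1↔⊤)
open import Data.List using (List; []; _∷_)
open import Data.Maybe using (Maybe; just; nothing)
open import Data.Nat
open import Data.Nat.Combinatorics using (_C_; nC1≡n; nCk+nC[k+1]≡[n+1]C[k+1])
open import Data.Nat.DivMod using (m*n/n≡m)
open import Data.Nat.Properties
open import Data.Nat.Tactic.RingSolver using (solve-∀)
open import Data.Product using (Σ; _×_; _,_; proj₁; proj₂)
open import Data.Sum using (_⊎_; inj₁; inj₂)
open import Data.Sum.Function.Propositional using (_⊎-↔_)
open import Data.Unit using (⊤; tt)
open import Data.Vec using (Vec; []; _∷_; _++_; take; drop)
open import Data.Vec.Properties using (take++drop≡id; ++-injective)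
open import Function.Bundles using (_↔_; mk↔ₛ′; Equivalence)
open import Function.Properties.Inverse using (↔-sym; ↔-trans)
open import Relation.Binary.PropositionalEquality
open ≡-Reasoning

sized-≡ : ∀ {A : Set} {size : A → ℕ} {n} {x y : A} {p : size x ≡ n} {q : size y ≡ n} →
          x ≡ y → _≡_ {A = Σ A (λ z → size z ≡ n)} (x , p) (y , q)
sized-≡ refl = cong (_ ,_) (≡-irrelevant _ _)

valid-sized-≡ : ∀ {A : Set} {valid : A → Bool} {size : A → ℕ} {n} {x y : A}
                {v : valid x ≡ true} {w : valid y ≡ true} {p : size x ≡ n} {q : size y ≡ n} →
                x ≡ y → _≡_ {A = Σ A (λ z → (valid z ≡ true) × (size z ≡ n))} (x , v , p) (y , w , q)
valid-sized-≡ refl = cong₂ (λ v p → _ , v , p) (Decidable⇒UIP.≡-irrelevant Bool._≟_ _ _) (≡-irrelevant _ _)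

[k+1]*[n+1]C[k+1]≡[n+1]*nCk : ∀ n k → suc k * (suc n C suc k) ≡ suc n * (n C k)
[k+1]*[n+1]C[k+1]≡[n+1]*nCk zero    zero    = refl
[k+1]*[n+1]C[k+1]≡[n+1]*nCk zero    (suc k) = *-zeroʳ (suc (suc k))
[k+1]*[n+1]C[k+1]≡[n+1]*nCk (suc n) zero    = begin
  1 * (suc (suc n) C 1) ≡⟨ *-identityˡ _ ⟩
  suc (suc n) C 1       ≡⟨ nC1≡n (suc (suc n)) ⟩
  suc (suc n)           ≡⟨ *-identityʳ (suc (suc n)) ⟨
  suc (suc n) * 1       ∎
[k+1]*[n+1]C[k+1]≡[n+1]*nCk (suc n) (suc k) = begin
  suc (suc k) * (suc (suc n) C suc (suc k))
    ≡⟨ cong (suc (suc k) *_) (nCk+nC[k+1]≡[n+1]C[k+1] (suc n) (suc k)) ⟨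
  suc (suc k) * (a + b)
    ≡⟨ *-distribˡ-+ (suc (suc k)) a b ⟩
  a + suc k * a + suc (suc k) * b
    ≡⟨ cong₂ (λ x y → a + x + y) ([k+1]*[n+1]C[k+1]≡[n+1]*nCk n k)
                                 ([k+1]*[n+1]C[k+1]≡[n+1]*nCk n (suc k)) ⟩
  a + suc n * (n C k) + suc n * (n C suc k)
    ≡⟨ +-assoc a _ _ ⟩
  a + (suc n * (n C k) + suc n * (n C suc k))
    ≡⟨ cong (a +_) (*-distribˡ-+ (suc n) (n C k) (n C suc k)) ⟨
  a + suc n * (n C k + n C suc k)
    ≡⟨ cong (λ x → a + suc n * x) (nCk+nC[k+1]≡[n+1]C[k+1] n k) ⟩
  suc (suc n) * a ∎
  where
  a = suc n C suc k
  b = suc n C suc (suc k)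

module _ (d : ℕ) where

  Forest : ℕ → ℕ → Set
  Forest h s = Σ (Vec (Maybe (DTree d)) h) (λ v → dsizes v ≡ s)

  raney : ℕ → ℕ → ℕ
  raney h       zero    = 1
  raney zero    (suc s) = 0
  raney (suc h) (suc s) = raney h (suc s) + raney (d + h) s

  dsizes-++ : ∀ {m n} (u : Vec (Maybe (DTree d)) m) (v : Vec (Maybe (DTree d)) n) →
              dsizes (u ++ v) ≡ dsizes u + dsizes v
  dsizes-++ []            v = refl
  dsizes-++ (nothing ∷ u) v = dsizes-++ u v
  dsizes-++ (just t ∷ u)  v = trans (cong (dsize t +_) (dsizes-++ u v)) (sym (+-assoc (dsize t) _ _))

  Forest[0,0]↔⊤ : Forest 0 0 ↔ ⊤
  Forest[0,0]↔⊤ = mk↔ₛ′ (λ _ → tt) (λ _ → [] , refl) (λ _ → refl) (λ { ([] , _) → sized-≡ refl })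

  Forest[0,1+s]↔⊥ : ∀ s → Forest 0 (suc s) ↔ ⊥
  Forest[0,1+s]↔⊥ s = mk↔ₛ′ (λ { ([] , ()) }) (λ ()) (λ ()) (λ { ([] , ()) })

  Forest[1+h,0]↔Forest[h,0] : ∀ h → Forest (suc h) 0 ↔ Forest h 0
  Forest[1+h,0]↔Forest[h,0] h = mk↔ₛ′ to (λ { (v , p) → nothing ∷ v , p }) (λ _ → refl) from∘to
    where
    to : Forest (suc h) 0 → Forest h 0
    to (nothing ∷ v , p)        = v , p
    to (just (node _) ∷ _ , ())
    from∘to : ∀ f → (nothing ∷ proj₁ (to f) , proj₂ (to f)) ≡ f
    from∘to (nothing ∷ v , p)        = refl
    from∘to (just (node _) ∷ _ , ())

  Forest[1+h,1+s]↔⊎ : ∀ h s → Forest (suc h) (suc s) ↔ (Forest h (suc s) ⊎ Forest (d + h) s)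
  Forest[1+h,1+s]↔⊎ h s = mk↔ₛ′ to from to∘from from∘to
    where
    to : Forest (suc h) (suc s) → Forest h (suc s) ⊎ Forest (d + h) s
    to (nothing ∷ v , p)        = inj₁ (v , p)
    to (just (node cs) ∷ v , p) = inj₂ (cs ++ v , trans (dsizes-++ cs v) (suc-injective p))
    from : Forest h (suc s) ⊎ Forest (d + h) s → Forest (suc h) (suc s)
    from (inj₁ (v , p)) = nothing ∷ v , p
    from (inj₂ (w , p)) = just (node (take d w)) ∷ drop d w ,
      cong suc (trans (sym (dsizes-++ (take d w) (drop d w))) (trans (cong dsizes (take++drop≡id d w)) p))
    to∘from : ∀ f → to (from f) ≡ f
    to∘from (inj₁ _)       = refl
    to∘from (inj₂ (w , _)) = cong inj₂ (sized-≡ (take++drop≡id d w))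
    from∘to : ∀ f → from (to f) ≡ f
    from∘to (nothing ∷ v , p)        = refl
    from∘to (just (node cs) ∷ v , p) with ++-injective (take d (cs ++ v)) cs (take++drop≡id d (cs ++ v))
    ... | take≡cs , drop≡v = sized-≡ (cong₂ (λ u w → just (node u) ∷ w) take≡cs drop≡v)

  Forest↔Fin[raney] : ∀ h s → Forest h s ↔ Fin (raney h s)
  Forest↔Fin[raney] zero    zero    = ↔-trans Forest[0,0]↔⊤ (↔-sym 1↔⊤)
  Forest↔Fin[raney] (suc h) zero    = ↔-trans (Forest[1+h,0]↔Forest[h,0] h) (Forest↔Fin[raney] h zero)
  Forest↔Fin[raney] zero    (suc s) = ↔-trans (Forest[0,1+s]↔⊥ s) (↔-sym 0↔⊥)
  Forest↔Fin[raney] (suc h) (suc s) = ↔-trans (Forest[1+h,1+s]↔⊎ h s)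
    (↔-trans (Forest↔Fin[raney] h (suc s) ⊎-↔ Forest↔Fin[raney] (d + h) s) (↔-sym +↔⊎))

  DAryTrees[1+m]↔Forest[d,m] : ∀ m → DAryTrees d (suc m) ↔ Forest d m
  DAryTrees[1+m]↔Forest[d,m] m = mk↔ₛ′ (λ { (node cs , p) → cs , suc-injective p })
    (λ { (cs , p) → node cs , cong suc p }) (λ _ → sized-≡ refl) (λ { (node _ , _) → sized-≡ refl })

module _ (d : ℕ) .{{_ : NonZero d}} where

  raney-step : ∀ h s {G₁ G₂ C₀ C₁} → let N = h + suc s * d in
    N * G₁ ≡ h * C₁ → N * G₂ ≡ (d + h) * C₀ → suc s * (C₀ + C₁) ≡ suc N * C₀ →
    suc N * (G₁ + G₂) ≡ suc h * (C₀ + C₁)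
  raney-step h s {G₁} {G₂} {C₀} {C₁} NG₁ NG₂ absorption =
    -- multiplied by N and s+1, the step becomes a ring identity after substituting absorption
    *-cancelˡ-≡ _ _ N (*-cancelˡ-≡ _ _ (suc s) (begin
      suc s * (N * (suc N * (G₁ + G₂)))              ≡⟨ expand₁ (suc s) N G₁ G₂ ⟩
      suc s * suc N * (N * G₁ + N * G₂)              ≡⟨ cong₂ (λ x y → suc s * suc N * (x + y)) NG₁ NG₂ ⟩
      suc s * suc N * (h * C₁ + (d + h) * C₀)        ≡⟨ expand₂ (suc s) (suc N) h d C₀ C₁ ⟩
      suc s * suc N * h * (C₀ + C₁) + d * (suc s * (suc N * C₀))
        ≡⟨ cong (λ x → suc s * suc N * h * (C₀ + C₁) + d * (suc s * x)) absorption ⟨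
      suc s * suc N * h * (C₀ + C₁) + d * (suc s * (suc s * (C₀ + C₁)))
        ≡⟨ collect h s d (C₀ + C₁) ⟩
      suc s * (N * (suc h * (C₀ + C₁)))              ∎))
    where
    N = h + suc s * d
    instance
      N≢0 : NonZero N
      N≢0 = >-nonZero (<-≤-trans (>-nonZero⁻¹ (suc s * d) {{m*n≢0 (suc s) d}}) (m≤n+m _ h))
    expand₁ : ∀ a n g₁ g₂ → a * (n * (suc n * (g₁ + g₂))) ≡ a * suc n * (n * g₁ + n * g₂)
    expand₁ = solve-∀
    expand₂ : ∀ a b h d c₀ c₁ → a * b * (h * c₁ + (d + h) * c₀) ≡ a * b * h * (c₀ + c₁) + d * (a * (b * c₀))
    expand₂ = solve-∀
    collect : ∀ h s d c → suc s * suc (h + suc s * d) * h * c + d * (suc s * (suc s * c))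
                          ≡ suc s * ((h + suc s * d) * (suc h * c))
    collect = solve-∀

  raney-closed : ∀ h s → (h + s * d) * raney d h s ≡ h * ((h + s * d) C s)
  raney-closed h       zero    = trans (*-identityʳ (h + 0)) (trans (+-identityʳ h) (sym (*-identityʳ h)))
  raney-closed zero    (suc s) = *-zeroʳ (suc s * d)
  raney-closed (suc h) (suc s) = begin
    suc N * (raney d h (suc s) + raney d (d + h) s)
      ≡⟨ raney-step h s (raney-closed h (suc s)) shifted absorption ⟩
    suc h * (N C s + N C suc s) ≡⟨ cong (suc h *_) pascal ⟩
    suc h * (suc N C suc s)     ∎
    where
    N = h + suc s * d
    pascal : N C s + N C suc s ≡ suc N C suc s
    pascal = nCk+nC[k+1]≡[n+1]C[k+1] N s
    absorption : suc s * (N C s + N C suc s) ≡ suc N * (N C s)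
    absorption = trans (cong (suc s *_) pascal) ([k+1]*[n+1]C[k+1]≡[n+1]*nCk N s)
    reassoc : d + h + s * d ≡ N
    reassoc = trans (cong (_+ s * d) (+-comm d h)) (+-assoc h d (s * d))
    shifted : N * raney d (d + h) s ≡ (d + h) * (N C s)
    shifted = subst (λ M → M * raney d (d + h) s ≡ (d + h) * (M C s)) reassoc (raney-closed (d + h) s)

  fussCatalan≡raney : ∀ m → ((suc m * d) C m) / suc m ≡ raney d d m
  fussCatalan≡raney m = begin
    ((suc m * d) C m) / suc m    ≡⟨ cong (_/ suc m) raney*[1+m]≡C ⟨
    raney d d m * suc m / suc m  ≡⟨ m*n/n≡m (raney d d m) (suc m) ⟩
    raney d d m                  ∎
    where
    raney*[1+m]≡C : raney d d m * suc m ≡ (suc m * d) C m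
    raney*[1+m]≡C = *-cancelˡ-≡ _ _ d (begin
      d * (raney d d m * suc m)  ≡⟨ reorder m d (raney d d m) ⟩
      (d + m * d) * raney d d m  ≡⟨ raney-closed d m ⟩
      d * ((suc m * d) C m)      ∎)
      where
      reorder : ∀ m d r → d * (r * suc m) ≡ (d + m * d) * r
      reorder = solve-∀

∧-≡-true : ∀ {a b} → a ≡ true → b ≡ true → a ∧ b ≡ true
∧-≡-true refl refl = refl

∧-≡-true⁻¹ : ∀ {a b} → a ∧ b ≡ true → (a ≡ true) × (b ≡ true)
∧-≡-true⁻¹ {true} {true} _ = refl , refl

module _ (d : ℕ) where

  addEdge : List (ℕ × MTree) → List (ℕ × MTree)
  addEdge []            = []
  addEdge ((m , t) ∷ r) = (suc m , t) ∷ r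

  mutual
    toPositions : ∀ h → List (ℕ × MTree) → Vec (Maybe (DTree d)) h
    toPositions zero    _                 = []
    toPositions (suc h) []                = nothing ∷ toPositions h []
    toPositions (suc h) ((zero , t) ∷ r)  = just (toDTree t) ∷ toPositions h r
    toPositions (suc h) ((suc m , t) ∷ r) = nothing ∷ toPositions h ((m , t) ∷ r)

    toDTree : MTree → DTree d
    toDTree (node cs) = node (toPositions d cs)

  mutual
    fromPositions : ∀ {h} → Vec (Maybe (DTree d)) h → List (ℕ × MTree)
    fromPositions []            = []
    fromPositions (nothing ∷ v) = addEdge (fromPositions v)
    fromPositions (just t ∷ v)  = (zero , fromDTree t) ∷ fromPositions v

    fromDTree : DTree d → MTree
    fromDTree (node cs) = node (fromPositions cs)

  msizes-addEdge : ∀ l → msizes (addEdge l) ≡ msizes l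
  msizes-addEdge []      = refl
  msizes-addEdge (_ ∷ _) = refl

  mutual
    msizes-fromPositions : ∀ {h} (v : Vec (Maybe (DTree d)) h) → msizes (fromPositions v) ≡ dsizes v
    msizes-fromPositions []            = refl
    msizes-fromPositions (nothing ∷ v) = trans (msizes-addEdge (fromPositions v)) (msizes-fromPositions v)
    msizes-fromPositions (just t ∷ v)  = cong₂ _+_ (msize-fromDTree t) (msizes-fromPositions v)

    msize-fromDTree : ∀ t → msize (fromDTree t) ≡ dsize t
    msize-fromDTree (node cs) = cong suc (msizes-fromPositions cs)

  outdeg-addEdge : ∀ l → outdeg (addEdge l) ≤ suc (outdeg l)
  outdeg-addEdge []      = z≤n
  outdeg-addEdge (_ ∷ _) = ≤-refl

  outdeg-fromPositions : ∀ {h} (v : Vec (Maybe (DTree d)) h) → outdeg (fromPositions v) ≤ h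
  outdeg-fromPositions []            = z≤n
  outdeg-fromPositions (nothing ∷ v) = ≤-trans (outdeg-addEdge (fromPositions v)) (s≤s (outdeg-fromPositions v))
  outdeg-fromPositions (just _ ∷ v)  = s≤s (outdeg-fromPositions v)

  mDArys-addEdge : ∀ l → mDArys d (addEdge l) ≡ mDArys d l
  mDArys-addEdge []      = refl
  mDArys-addEdge (_ ∷ _) = refl

  mutual
    mDArys-fromPositions : ∀ {h} (v : Vec (Maybe (DTree d)) h) → mDArys d (fromPositions v) ≡ true
    mDArys-fromPositions []            = refl
    mDArys-fromPositions (nothing ∷ v) = trans (mDArys-addEdge (fromPositions v)) (mDArys-fromPositions v)
    mDArys-fromPositions (just t ∷ v)  = ∧-≡-true (mDAry-fromDTree t) (mDArys-fromPositions v)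

    mDAry-fromDTree : ∀ t → mDAry d (fromDTree t) ≡ true
    mDAry-fromDTree (node cs) =
      ∧-≡-true (Equivalence.to Bool.T-≡ (≤⇒≤ᵇ (outdeg-fromPositions cs))) (mDArys-fromPositions cs)

  toPositions-addEdge : ∀ h l → toPositions (suc h) (addEdge l) ≡ nothing ∷ toPositions h l
  toPositions-addEdge h []      = refl
  toPositions-addEdge h (_ ∷ _) = refl

  mutual
    toPositions-fromPositions : ∀ {h} (v : Vec (Maybe (DTree d)) h) → toPositions h (fromPositions v) ≡ v
    toPositions-fromPositions []            = refl
    toPositions-fromPositions (nothing ∷ v) =
      trans (toPositions-addEdge _ (fromPositions v)) (cong (nothing ∷_) (toPositions-fromPositions v))
    toPositions-fromPositions (just t ∷ v)  =
      cong₂ (λ u w → just u ∷ w) (toDTree-fromDTree t) (toPositions-fromPositions v)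

    toDTree-fromDTree : ∀ t → toDTree (fromDTree t) ≡ t
    toDTree-fromDTree (node cs) = cong node (toPositions-fromPositions cs)

  mutual
    fromPositions-toPositions : ∀ h l → outdeg l ≤ h → mDArys d l ≡ true → fromPositions (toPositions h l) ≡ l
    fromPositions-toPositions zero    []                _         _  = refl
    fromPositions-toPositions (suc h) []                _         _  =
      cong addEdge (fromPositions-toPositions h [] z≤n refl)
    fromPositions-toPositions (suc h) ((zero , t) ∷ r)  (s≤s deg) ok =
      cong₂ (λ u w → (zero , u) ∷ w) (fromDTree-toDTree t (proj₁ (∧-≡-true⁻¹ ok)))
                                     (fromPositions-toPositions h r deg (proj₂ (∧-≡-true⁻¹ ok)))
    fromPositions-toPositions (suc h) ((suc m , t) ∷ r) (s≤s deg) ok =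
      cong addEdge (fromPositions-toPositions h ((m , t) ∷ r) deg ok)

    fromDTree-toDTree : ∀ t → mDAry d t ≡ true → fromDTree (toDTree t) ≡ t
    fromDTree-toDTree (node cs) ok with ∧-≡-true⁻¹ ok
    ... | deg , oks = cong node (fromPositions-toPositions d cs (≤ᵇ⇒≤ _ _ (Equivalence.from Bool.T-≡ deg)) oks)

  dsize-toDTree : ∀ {t} → mDAry d t ≡ true → dsize (toDTree t) ≡ msize t
  dsize-toDTree {t} ok = trans (sym (msize-fromDTree (toDTree t))) (cong msize (fromDTree-toDTree t ok))

  DAryMultiEdgeTrees↔DAryTrees : ∀ n → DAryMultiEdgeTrees d n ↔ DAryTrees d n
  DAryMultiEdgeTrees↔DAryTrees n = mk↔ₛ′ to from (λ { (t , _) → sized-≡ (toDTree-fromDTree t) }) from∘to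
    where
    to : DAryMultiEdgeTrees d n → DAryTrees d n
    to (t , ok , p) = toDTree t , trans (dsize-toDTree ok) p
    from : DAryTrees d n → DAryMultiEdgeTrees d n
    from (t , p) = fromDTree t , mDAry-fromDTree t , trans (msize-fromDTree t) p
    from∘to : ∀ x → from (to x) ≡ x
    from∘to (t , ok , p) = valid-sized-≡ (fromDTree-toDTree t ok)

corollary2p1 : (d n : ℕ) → 1 ≤ d → .{{_ : NonZero n}} →
    (Fin (((n * d) C (n ∸ 1)) / n) ↔ DAryMultiEdgeTrees d n)
      × (Fin (((n * d) C (n ∸ 1)) / n) ↔ DAryTrees d n)
corollary2p1 d@(suc _) (suc m) (s≤s z≤n) = ↔-trans fin↔dary (↔-sym (DAryMultiEdgeTrees↔DAryTrees d (suc m))) , fin↔dary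
  where
  fin↔dary : Fin (((suc m * d) C m) / suc m) ↔ DAryTrees d (suc m)
  fin↔dary = subst (λ k → Fin k ↔ DAryTrees d (suc m)) (sym (fussCatalan≡raney d m))
    (↔-sym (↔-trans (DAryTrees[1+m]↔Forest[d,m] d m) (Forest↔Fin[raney] d d m)))
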